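{- Let $0 \to A \to B \to C \to 0$ be an exact sequence of finite $m$-torsion abelian groups, $m>1$. Then $\operatorname{rk}_m B \geq \operatorname{rk}_m A + \operatorname{rk}_m C$. Moreover, if $A$ or $C$ is isomorphic to $(\mathbb{Z}/m)^n$ for some $n$, then $\operatorname{rk}_m B = \operatorname{rk}_m A +\operatorname{rk}_m C$.
   Context: For a finitely generated abelian group $M$ and integer $m\geq 2$, $\operatorname{rk}_m M$ denotes the largest integer $r$ such that $M$ has a subgroup isomorphic to $(\mathbb{Z}/m)^r$. -}

module Defs where

open import Level using (0ℓ)
open import Data.Nat using (ℕ; _+_; _∸_; _≤_; NonZero)
open import Data.Nat.DivMod using (_mod_)
open import Data.Fin using (Fin; toℕ)
open import Data.Vec using (Vec; zipWith; replicate; map)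
open import Data.Product using (Σ; ∃; _×_)
open import Relation.Binary.PropositionalEquality using (_≡_)
open import Algebra.Bundles using (RawGroup; AbelianGroup)
open import Algebra.Morphism.Structures using (module GroupMorphisms)
import Algebra.Definitions.RawMonoid as RawMonoidDefs

_+ₘ_ : {m : ℕ} .{{_ : NonZero m}} → Fin m → Fin m → Fin m
_+ₘ_ {m} a b = (toℕ a + toℕ b) mod m

-ₘ_ : {m : ℕ} .{{_ : NonZero m}} → Fin m → Fin m
-ₘ_ {m} a = (m ∸ toℕ a) mod m

0ₘ : {m : ℕ} .{{_ : NonZero m}} → Fin m
0ₘ {m} = 0 mod m

ZmPow : (m : ℕ) .{{_ : NonZero m}} → (r : ℕ) → RawGroup 0ℓ 0ℓ
ZmPow m r = record
  { Carrier = Vec (Fin m) r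
  ; _≈_     = _≡_
  ; _∙_     = zipWith _+ₘ_
  ; ε       = replicate r 0ₘ
  ; _⁻¹     = map -ₘ_
  }

module _ (G : AbelianGroup 0ℓ 0ℓ) where
  open AbelianGroup G

  IsFinite : Set
  IsFinite = Σ ℕ λ n → Σ (Fin n → Carrier) λ enum → ∀ x → ∃ λ i → enum i ≈ x

  IsTorsion : ℕ → Set
  IsTorsion m = ∀ x → m ·ₙ x ≈ ε
    where open RawMonoidDefs rawMonoid using () renaming (_×_ to _·ₙ_)

  HasZmPowSubgroup : (m : ℕ) .{{_ : NonZero m}} → ℕ → Set
  HasZmPowSubgroup m r =
    Σ (Vec (Fin m) r → Carrier) λ f →
      GroupMorphisms.IsGroupMonomorphism (ZmPow m r) rawGroup f

  IsRank : (m : ℕ) .{{_ : NonZero m}} → ℕ → Set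
  IsRank m r = HasZmPowSubgroup m r × (∀ s → HasZmPowSubgroup m s → s ≤ r)

  IsoZmPow : (m : ℕ) .{{_ : NonZero m}} → ℕ → Set
  IsoZmPow m n =
    Σ (Vec (Fin m) n → Carrier) λ φ →
      GroupMorphisms.IsGroupIsomorphism (ZmPow m n) rawGroup φ

record ShortExact (A B C : AbelianGroup 0ℓ 0ℓ)
                  (f : AbelianGroup.Carrier A → AbelianGroup.Carrier B)
                  (g : AbelianGroup.Carrier B → AbelianGroup.Carrier C) : Set where
  open AbelianGroup A using () renaming (_≈_ to _≈A_)
  open AbelianGroup B using () renaming (_≈_ to _≈B_)
  open AbelianGroup C using () renaming (_≈_ to _≈C_; ε to εC)
  field
    f-hom      : GroupMorphisms.IsGroupHomomorphism
                   (AbelianGroup.rawGroup A) (AbelianGroup.rawGroup B) f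
    g-hom      : GroupMorphisms.IsGroupHomomorphism
                   (AbelianGroup.rawGroup B) (AbelianGroup.rawGroup C) g
    f-injective : ∀ {x y} → f x ≈B f y → x ≈A y
    g-surjective : ∀ c → ∃ λ b → g b ≈C c
    im⊆ker     : ∀ a → g (f a) ≈C εC
    ker⊆im     : ∀ b → g b ≈C εC → ∃ λ a → f a ≈B b

module Submission where

-- An m-torsion group is a ℤ/m-module, and a subgroup ≅ (ℤ/m)^r is the same as
-- a free family of length r.  Lower bound: a free family of A pushed into B,
-- together with lifts of a free family of C, is free in B.  Upper bound when
-- C ≅ (ℤ/m)^n: pull the n coordinate functionals of C back to B; kernel
-- reduction (2×2 Bézout moves) turns a maximal free family of B into a free
-- family of length rk B ∸ n in their common kernel ker g = im f, which lifts
-- to A.  Upper bound when A ≅ (ℤ/m)^n: transport the coordinate functionals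
-- of A to f(A) and extend them to B (ℤ/m is self-injective); after kernel
-- reduction, the image under g of the remaining family is free in C.  The
-- extension needs decidable equality on B, which a finite setoid has up to
-- double negation; since the inequality to prove is decidable, that suffices.

open import Level using (0ℓ)
open import Data.Nat using (ℕ; zero; suc; _+_; _∸_; _≤_; _<_; _≤?_; NonZero; s≤s; z≤n)
open import Data.Nat.Properties
  using (≤-refl; ≤-trans; ≤-antisym; ≤-reflexive; m≤n⇒m≤1+n; m<1+n⇒m<n∨m≡n; m≤n+m∸n; +-mono-≤; +-comm)
open import Data.Fin using (Fin)
open import Data.Vec using (Vec; []; _∷_; _++_; map; splitAt)
open import Data.Vec.Relation.Unary.All as All using (All; []; _∷_)
open import Data.Vec.Relation.Unary.All.Properties using (++⁺)
open import Data.Vec.Relation.Binary.Pointwise.Inductive using (Pointwise; []; _∷_)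
open import Data.Product using (Σ; _×_; _,_; proj₁; proj₂)
open import Data.Sum using (_⊎_; inj₁; inj₂)
open import Relation.Binary.PropositionalEquality using (_≡_)
open import Relation.Nullary using (Dec; yes; no; ¬_)
open import Relation.Nullary.Decidable using (decidable-stable)
open import Algebra.Bundles using (AbelianGroup)
open import Algebra.Morphism.Structures using (module GroupMorphisms)
open GroupMorphisms using (IsGroupIsomorphism)
open import Defs

-- Congruence modulo a modulus m ≥ 2, written m = k + 2 throughout the file.
-- It is wrapped in a record so that Agda does not unfold it during unification.
module Congruence (k : ℕ) where
  open import Data.Nat
  open import Data.Nat.Properties using (*-zeroʳ)
  open import Data.Nat.DivMod using (%-distribˡ-+; %-distribˡ-*; [m+kn]%n≡m%n; m%n%n≡m%n; m<n⇒m%n≡m)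
  open import Data.Nat.Divisibility using (_∣_; m%n≡0⇒n∣m)
  open import Data.Nat.Tactic.RingSolver using (solve-∀)
  open import Relation.Binary.PropositionalEquality using (refl; sym; trans; cong; cong₂; module ≡-Reasoning)
  open import Relation.Binary.Bundles using (Setoid)
  import Relation.Binary.Reasoning.Setoid

  m : ℕ
  m = suc (suc k)

  -- The representative of −1 modulo m.
  m-1 : ℕ
  m-1 = suc k

  infix 4 _≡ₘ_
  record _≡ₘ_ (a b : ℕ) : Set where
    constructor mk
    field residue : a % m ≡ b % m

  ≡ₘ-refl : ∀ {a} → a ≡ₘ a
  ≡ₘ-refl = mk refl

  ≡ₘ-sym : ∀ {a b} → a ≡ₘ b → b ≡ₘ a
  ≡ₘ-sym (mk p) = mk (sym p)

  ≡ₘ-trans : ∀ {a b c} → a ≡ₘ b → b ≡ₘ c → a ≡ₘ c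
  ≡ₘ-trans (mk p) (mk q) = mk (trans p q)

  ≡⇒≡ₘ : ∀ {a b} → a ≡ b → a ≡ₘ b
  ≡⇒≡ₘ p = mk (cong (_% m) p)

  ℕₘ-setoid : Setoid _ _
  ℕₘ-setoid = record
    { Carrier = ℕ ; _≈_ = _≡ₘ_
    ; isEquivalence = record { refl = ≡ₘ-refl ; sym = ≡ₘ-sym ; trans = ≡ₘ-trans } }

  module ≡ₘ-Reasoning = Relation.Binary.Reasoning.Setoid ℕₘ-setoid

  ≡ₘ-+ : ∀ {a a' b b'} → a ≡ₘ a' → b ≡ₘ b' → a + b ≡ₘ a' + b'
  ≡ₘ-+ {a} {a'} {b} {b'} (mk p) (mk q) = mk (begin
    (a + b) % m             ≡⟨ %-distribˡ-+ a b m ⟩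
    (a % m + b % m) % m     ≡⟨ cong₂ (λ u v → (u + v) % m) p q ⟩
    (a' % m + b' % m) % m   ≡⟨ %-distribˡ-+ a' b' m ⟨
    (a' + b') % m           ∎)
    where open ≡-Reasoning

  ≡ₘ-* : ∀ {a a' b b'} → a ≡ₘ a' → b ≡ₘ b' → a * b ≡ₘ a' * b'
  ≡ₘ-* {a} {a'} {b} {b'} (mk p) (mk q) = mk (begin
    (a * b) % m                 ≡⟨ %-distribˡ-* a b m ⟩
    (a % m * (b % m)) % m       ≡⟨ cong₂ (λ u v → (u * v) % m) p q ⟩
    (a' % m * (b' % m)) % m     ≡⟨ %-distribˡ-* a' b' m ⟨
    (a' * b') % m               ∎)
    where open ≡-Reasoning

  +-multiple : ∀ a t → a + t * m ≡ₘ a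
  +-multiple a t = mk ([m+kn]%n≡m%n a t m)

  ≡ₘ-via : ∀ {a} b t → a ≡ b + t * m → a ≡ₘ b
  ≡ₘ-via b t eq = ≡ₘ-trans (≡⇒≡ₘ eq) (+-multiple b t)

  %-≡ₘ : ∀ a → a % m ≡ₘ a
  %-≡ₘ a = mk (m%n%n≡m%n a m)

  ≡ₘ0⇒∣ : ∀ {a} → a ≡ₘ 0 → m ∣ a
  ≡ₘ0⇒∣ {a} (mk p) = m%n≡0⇒n∣m a m p

  <-≡ₘ⇒≡ : ∀ {a b} → a < m → b < m → a ≡ₘ b → a ≡ b
  <-≡ₘ⇒≡ p q (mk e) = trans (sym (m<n⇒m%n≡m p)) (trans e (m<n⇒m%n≡m q))

  -- a − b ≡ 0 implies a ≡ b, with −b represented by (m − 1)·b.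
  difference-≡ₘ0 : ∀ {a b} → a + m-1 * b ≡ₘ 0 → a ≡ₘ b
  difference-≡ₘ0 {a} {b} e = begin
    a                   ≈⟨ ≡ₘ-sym (+-multiple a b) ⟩
    a + b * m           ≡⟨ regroup k a b ⟩
    (a + m-1 * b) + b   ≈⟨ ≡ₘ-+ e ≡ₘ-refl ⟩
    b                   ∎
    where
    open ≡ₘ-Reasoning
    regroup : ∀ j a b → a + b * suc (suc j) ≡ (a + suc j * b) + b
    regroup = solve-∀

  combination-null : ∀ α β {s t} → s ≡ₘ 0 → t ≡ₘ 0 → α * s + β * t ≡ₘ 0
  combination-null α β s≡0 t≡0 = ≡ₘ-trans (≡ₘ-+ (≡ₘ-* (≡ₘ-refl {α}) s≡0) (≡ₘ-* (≡ₘ-refl {β}) t≡0))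
                                   (≡⇒≡ₘ (cong₂ _+_ (*-zeroʳ α) (*-zeroʳ β)))

  -- Cancellation: add (m − 1)·a to both sides.
  ≡ₘ-cancelˡ : ∀ a {b c} → a + b ≡ₘ a + c → b ≡ₘ c
  ≡ₘ-cancelˡ a {b} {c} e = begin
    b                       ≈⟨ ≡ₘ-sym (+-multiple b a) ⟩
    b + a * m               ≡⟨ shift-identity k a b ⟩
    (a + b) + m-1 * a       ≈⟨ ≡ₘ-+ e ≡ₘ-refl ⟩
    (a + c) + m-1 * a       ≡⟨ shift-identity k a c ⟨
    c + a * m               ≈⟨ +-multiple c a ⟩
    c                       ∎
    where
    open ≡ₘ-Reasoning
    shift-identity : ∀ j a x → x + a * suc (suc j) ≡ (a + x) + suc j * a
    shift-identity = solve-∀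

module TorsionGroup (k : ℕ) (G : AbelianGroup 0ℓ 0ℓ) (tor : IsTorsion G (Congruence.m k)) where
  open import Data.Nat
  open import Data.Nat.Properties using (+-identityʳ)
  open import Data.Nat.DivMod using (m≡m%n+[m/n]*n)
  open import Data.Vec using (zipWith; replicate)
  open import Data.Unit using (⊤; tt)
  import Relation.Binary.PropositionalEquality as ≡
  open import Algebra.Definitions.RawMonoid using () renaming (_×_ to multiple)
  import Relation.Binary.Reasoning.Setoid

  open Congruence k
  open AbelianGroup G public
  open import Algebra.Properties.CommutativeMonoid.Mult commutativeMonoid
    using (×-congʳ; ×-homo-+; ×-assocˡ; ×-distrib-+)
  open import Algebra.Properties.CommutativeSemigroup commutativeSemigroup public
    using (interchange; x∙yz≈y∙xz)

  module ≈-Reasoning = Relation.Binary.Reasoning.Setoid setoid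

  infixr 8 _·_
  _·_ : ℕ → Carrier → Carrier
  _·_ = multiple rawMonoid

  ·-cong : ∀ n {x y} → x ≈ y → n · x ≈ n · y
  ·-cong = ×-congʳ

  ·-+ : ∀ a b x → (a + b) · x ≈ a · x ∙ b · x
  ·-+ a b x = ×-homo-+ x a b

  ·-* : ∀ a b x → a · b · x ≈ (a * b) · x
  ·-* a b x = ×-assocˡ x a b

  ·-∙ : ∀ n x y → n · (x ∙ y) ≈ n · x ∙ n · y
  ·-∙ n x y = ×-distrib-+ x y n

  ·-ε : ∀ n → n · ε ≈ ε
  ·-ε zero    = refl
  ·-ε (suc n) = trans (identityˡ _) (·-ε n)

  -- Because m · x = ε, the action of a only depends on a mod m.
  ·-% : ∀ a x → a · x ≈ (a % m) · x
  ·-% a x = begin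
    a · x                               ≡⟨ ≡.cong (_· x) (m≡m%n+[m/n]*n a m) ⟩
    (a % m + (a / m) * m) · x           ≈⟨ ·-+ (a % m) ((a / m) * m) x ⟩
    (a % m) · x ∙ ((a / m) * m) · x     ≈⟨ ∙-congˡ (·-* (a / m) m x) ⟨
    (a % m) · x ∙ (a / m) · m · x       ≈⟨ ∙-congˡ (·-cong (a / m) (tor x)) ⟩
    (a % m) · x ∙ (a / m) · ε           ≈⟨ ∙-congˡ (·-ε (a / m)) ⟩
    (a % m) · x ∙ ε                     ≈⟨ identityʳ _ ⟩
    (a % m) · x                         ∎
    where open ≈-Reasoning

  ·-≡ₘ : ∀ {a b} x → a ≡ₘ b → a · x ≈ b · x
  ·-≡ₘ {a} {b} x (mk e) =
    trans (·-% a x) (trans (reflexive (≡.cong (_· x) e)) (sym (·-% b x)))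

  m-1·x∙x≈ε : ∀ x → m-1 · x ∙ x ≈ ε
  m-1·x∙x≈ε x = trans (comm _ _) (tor x)

  lin : ∀ {r} → Vec ℕ r → Vec Carrier r → Carrier
  lin []       []       = ε
  lin (x ∷ xs) (b ∷ bs) = x · b ∙ lin xs bs

  Null : ∀ {r} → Vec ℕ r → Set
  Null = All (_≡ₘ 0)

  Free : ∀ {r} → Vec Carrier r → Set
  Free bs = ∀ xs → lin xs bs ≈ ε → Null xs

  zeros : ∀ r → Vec ℕ r
  zeros r = replicate r 0

  lin-zeros : ∀ {r} (bs : Vec Carrier r) → lin (zeros r) bs ≈ ε
  lin-zeros []       = refl
  lin-zeros (b ∷ bs) = trans (identityˡ _) (lin-zeros bs)

  lin-null : ∀ {r} (xs : Vec ℕ r) bs → Null xs → lin xs bs ≈ ε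
  lin-null []       []       []       = refl
  lin-null (x ∷ xs) (b ∷ bs) (n ∷ ns) =
    trans (∙-cong (·-≡ₘ b n) (lin-null xs bs ns)) (identityˡ ε)

  lin-≡ₘ : ∀ {r} {xs ys : Vec ℕ r} bs → Pointwise _≡ₘ_ xs ys → lin xs bs ≈ lin ys bs
  lin-≡ₘ []       []       = refl
  lin-≡ₘ (b ∷ bs) (e ∷ es) = ∙-cong (·-≡ₘ b e) (lin-≡ₘ bs es)

  lin-cong : ∀ {r} (xs : Vec ℕ r) {bs cs} → Pointwise _≈_ bs cs → lin xs bs ≈ lin xs cs
  lin-cong []       []       = refl
  lin-cong (x ∷ xs) (e ∷ es) = ∙-cong (·-cong x e) (lin-cong xs es)

  lin-+ : ∀ {r} (xs ys : Vec ℕ r) bs → lin (zipWith _+_ xs ys) bs ≈ lin xs bs ∙ lin ys bs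
  lin-+ []       []       []       = sym (identityˡ ε)
  lin-+ (x ∷ xs) (y ∷ ys) (b ∷ bs) =
    trans (∙-cong (·-+ x y b) (lin-+ xs ys bs)) (interchange _ _ _ _)

  lin-* : ∀ {r} c (xs : Vec ℕ r) bs → lin (map (c *_) xs) bs ≈ c · lin xs bs
  lin-* c []       []       = sym (·-ε c)
  lin-* c (x ∷ xs) (b ∷ bs) =
    trans (∙-cong (sym (·-* c x b)) (lin-* c xs bs)) (sym (·-∙ c _ _))

  lin-++ : ∀ {r s} (xs : Vec ℕ r) (ys : Vec ℕ s) as bs →
           lin (xs ++ ys) (as ++ bs) ≈ lin xs as ∙ lin ys bs
  lin-++ []       ys []       bs = sym (identityˡ _)
  lin-++ (x ∷ xs) ys (a ∷ as) bs = trans (∙-congˡ (lin-++ xs ys as bs)) (sym (assoc _ _ _))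

  record Subgroup (Q : Carrier → Set) : Set where
    field
      ∈-ε : Q ε
      ∈-∙ : ∀ {x y} → Q x → Q y → Q (x ∙ y)
      ∈-≈ : ∀ {x y} → x ≈ y → Q x → Q y

    ∈-· : ∀ n {x} → Q x → Q (n · x)
    ∈-· zero    q = ∈-ε
    ∈-· (suc n) q = ∈-∙ q (∈-· n q)

    ∈-lin : ∀ {r} (xs : Vec ℕ r) {bs} → All Q bs → Q (lin xs bs)
    ∈-lin []       []       = ∈-ε
    ∈-lin (x ∷ xs) (q ∷ qs) = ∈-∙ (∈-· x q) (∈-lin xs qs)

    -- Subgroups are closed under differences, since −x = (m − 1) · x.
    ∈-cancelˡ : ∀ {x y} → Q (x ∙ y) → Q x → Q y
    ∈-cancelˡ {x} {y} qxy qx = ∈-≈ eq (∈-∙ qxy (∈-· m-1 qx))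
      where
      eq : (x ∙ y) ∙ m-1 · x ≈ y
      eq = begin
        (x ∙ y) ∙ m-1 · x   ≈⟨ ∙-congʳ (comm x y) ⟩
        (y ∙ x) ∙ m-1 · x   ≈⟨ assoc y x _ ⟩
        y ∙ (x ∙ m-1 · x)   ≈⟨ ∙-congˡ (comm x _) ⟩
        y ∙ (m-1 · x ∙ x)   ≈⟨ ∙-congˡ (m-1·x∙x≈ε x) ⟩
        y ∙ ε               ≈⟨ identityʳ y ⟩
        y                   ∎
        where open ≈-Reasoning

  open Subgroup public

  Pres : ∀ {r s} → Vec Carrier r → Vec Carrier s → Set₁
  Pres bs ds = ∀ Q → Subgroup Q → All Q bs → All Q ds

  InSpan : ∀ {r} → Vec Carrier r → Carrier → Set
  InSpan bs y = Σ _ λ xs → lin xs bs ≈ y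

  span-subgroup : ∀ {r} (bs : Vec Carrier r) → Subgroup (InSpan bs)
  span-subgroup bs = record
    { ∈-ε = zeros _ , lin-zeros bs
    ; ∈-∙ = λ { (xs , p) (ys , q) → zipWith _+_ xs ys , trans (lin-+ xs ys bs) (∙-cong p q) }
    ; ∈-≈ = λ { e (xs , p) → xs , trans p e } }

  -- A map to ℕ that is additive mod m on a subgroup S, i.e. a homomorphism
  -- S → ℤ/m; it sends ε to 0 and n · x to n times its value.
  module AdditiveOn {S : Carrier → Set} (S-sub : Subgroup S) (φ : Carrier → ℕ)
                    (φ-cong : ∀ {x y} → S x → x ≈ y → φ x ≡ₘ φ y)
                    (φ-∙ : ∀ {x y} → S x → S y → φ (x ∙ y) ≡ₘ φ x + φ y) where
    φ-ε : φ ε ≡ₘ 0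
    φ-ε = ≡ₘ-cancelˡ (φ ε) (begin
      φ ε + φ ε   ≈⟨ φ-∙ sε sε ⟨
      φ (ε ∙ ε)   ≈⟨ φ-cong (∈-∙ S-sub sε sε) (identityˡ ε) ⟩
      φ ε         ≡⟨ +-identityʳ _ ⟨
      φ ε + 0     ∎)
      where
      open ≡ₘ-Reasoning
      sε : S ε
      sε = ∈-ε S-sub

    φ-· : ∀ n {x} → S x → φ (n · x) ≡ₘ n * φ x
    φ-· zero    s = φ-ε
    φ-· (suc n) s = ≡ₘ-trans (φ-∙ s (∈-· S-sub n s)) (≡ₘ-+ ≡ₘ-refl (φ-· n s))

  -- Functionals: homomorphisms G → ℤ/m, with values represented in ℕ.
  record Functional : Set where
    field
      ap     : Carrier → ℕ
      ap-cong : ∀ {x y} → x ≈ y → ap x ≡ₘ ap y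
      ap-∙   : ∀ x y → ap (x ∙ y) ≡ₘ ap x + ap y

  whole : Subgroup (λ _ → ⊤)
  whole = record { ∈-ε = tt ; ∈-∙ = λ _ _ → tt ; ∈-≈ = λ _ _ → tt }

  module _ (F : Functional) where
    open Functional F
    private module Additive = AdditiveOn whole ap (λ _ → ap-cong) (λ {x} {y} _ _ → ap-∙ x y)

    ap-ε : ap ε ≡ₘ 0
    ap-ε = Additive.φ-ε

    ap-· : ∀ n x → ap (n · x) ≡ₘ n * ap x
    ap-· n x = Additive.φ-· n tt

    Ker : Carrier → Set
    Ker x = ap x ≡ₘ 0

    ker-subgroup : Subgroup Ker
    ker-subgroup = record
      { ∈-ε = ap-ε
      ; ∈-∙ = λ p q → ≡ₘ-trans (ap-∙ _ _) (≡ₘ-+ p q)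
      ; ∈-≈ = λ e p → ≡ₘ-trans (≡ₘ-sym (ap-cong e)) p }

module ZmVectors (k : ℕ) where
  open import Data.Nat
  open import Data.Nat.Properties using (m∸n+n≡m; <⇒≤; +-identityʳ; *-identityˡ)
  open import Data.Nat.DivMod using (_mod_; m%n<n)
  open import Data.Fin using (toℕ; zero; suc)
  open import Data.Fin.Properties using (toℕ-fromℕ<; toℕ<n; toℕ-injective)
  open import Data.Vec using (zipWith; replicate)
  open import Relation.Binary.PropositionalEquality

  open Congruence k

  toℕ-mod : ∀ n → toℕ (n mod m) ≡ₘ n
  toℕ-mod n = ≡ₘ-trans (≡⇒≡ₘ (toℕ-fromℕ< (m%n<n n m))) (%-≡ₘ n)

  fin-≡ₘ⇒≡ : ∀ {a b : Fin m} → toℕ a ≡ₘ toℕ b → a ≡ b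
  fin-≡ₘ⇒≡ {a} {b} e = toℕ-injective (<-≡ₘ⇒≡ (toℕ<n a) (toℕ<n b) e)

  mod-toℕ : ∀ (a : Fin m) → toℕ a mod m ≡ a
  mod-toℕ a = fin-≡ₘ⇒≡ (toℕ-mod (toℕ a))

  toℕ-+ₘ : ∀ (a b : Fin m) → toℕ (a +ₘ b) ≡ₘ toℕ a + toℕ b
  toℕ-+ₘ a b = toℕ-mod (toℕ a + toℕ b)

  +ₘ-identityʳ : ∀ (a : Fin m) → a +ₘ zero ≡ a
  +ₘ-identityʳ a = fin-≡ₘ⇒≡ (≡ₘ-trans (toℕ-+ₘ a zero) (≡⇒≡ₘ (+-identityʳ (toℕ a))))

  suc-mod : ∀ n → suc n mod m ≡ suc zero +ₘ (n mod m)
  suc-mod n = fin-≡ₘ⇒≡ (≡ₘ-trans (toℕ-mod (suc n))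
                (≡ₘ-sym (≡ₘ-trans (toℕ-+ₘ (suc zero) (n mod m)) (≡ₘ-+ (≡ₘ-refl {1}) (toℕ-mod n)))))

  coords : ∀ {r} → Vec (Fin m) r → Vec ℕ r
  coords = map toℕ

  coords-+ : ∀ {r} (v w : Vec (Fin m) r) →
             Pointwise _≡ₘ_ (coords (zipWith _+ₘ_ v w)) (zipWith _+_ (coords v) (coords w))
  coords-+ []      []      = []
  coords-+ (a ∷ v) (b ∷ w) = toℕ-+ₘ a b ∷ coords-+ v w

  coords-0 : ∀ r → coords (replicate r (0ₘ {m})) ≡ replicate r 0
  coords-0 zero    = refl
  coords-0 (suc r) = cong (0 ∷_) (coords-0 r)

  -- −a + a ≡ m ≡ 0 coordinatewise.
  coords-neg : ∀ {r} (v : Vec (Fin m) r) →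
               Pointwise _≡ₘ_ (zipWith _+_ (coords (map -ₘ_ v)) (coords v)) (replicate r 0)
  coords-neg []      = []
  coords-neg (a ∷ v) = neg-a+a ∷ coords-neg v
    where
    neg-a+a : toℕ (-ₘ a) + toℕ a ≡ₘ 0
    neg-a+a = ≡ₘ-trans (≡ₘ-+ (toℕ-mod (m ∸ toℕ a)) ≡ₘ-refl)
                (≡ₘ-trans (≡⇒≡ₘ (m∸n+n≡m (<⇒≤ (toℕ<n a)))) (≡ₘ-via 0 1 (sym (*-identityˡ m))))

  coords-injective : ∀ {r} (v w : Vec (Fin m) r) → Pointwise _≡ₘ_ (coords v) (coords w) → v ≡ w
  coords-injective []      []      []       = refl
  coords-injective (a ∷ v) (b ∷ w) (e ∷ es) = cong₂ _∷_ (fin-≡ₘ⇒≡ e) (coords-injective v w es)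

  basis : ∀ r → Vec (Vec (Fin m) r) r
  basis zero    = []
  basis (suc r) = (suc zero ∷ replicate r zero) ∷ map (zero ∷_) (basis r)

  zeros-+ : ∀ {r} (w : Vec (Fin m) r) → zipWith _+ₘ_ (replicate r zero) w ≡ w
  zeros-+ []      = refl
  zeros-+ (b ∷ w) = cong₂ _∷_ (mod-toℕ b) (zeros-+ w)

-- Subgroups ≅ (ℤ/m)^r are the same as free families of length r: a free
-- family spans a copy of (ℤ/m)^r, and the images of the standard basis under
-- an embedding (ℤ/m)^r → G form a free family spanning the image.
module FreeFamilies (k : ℕ) (G : AbelianGroup 0ℓ 0ℓ) (tor : IsTorsion G (Congruence.m k)) where
  open import Data.Nat
  open import Data.Nat.DivMod using (_mod_)
  open import Data.Fin using (toℕ; zero; suc)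
  open import Data.Vec using (zipWith; replicate)
  open import Data.Vec.Properties using (map-∘; ∷-injectiveˡ; ∷-injectiveʳ)
  open import Function using (_∘_)
  import Relation.Binary.PropositionalEquality as ≡
  open GroupMorphisms using (IsGroupMonomorphism)

  open Congruence k
  open ZmVectors k
  open TorsionGroup k G tor
  import Algebra.Properties.Group group as GroupProperties

  cyclic-hom : (h : Fin m → Carrier) → (∀ a b → h (a +ₘ b) ≈ h a ∙ h b) → h zero ≈ ε →
               ∀ a → h a ≈ toℕ a · h (suc zero)
  cyclic-hom h h-∙ h-ε a = trans (reflexive (≡.cong h (≡.sym (mod-toℕ a)))) (on-residues (toℕ a))
    where
    on-residues : ∀ n → h (n mod m) ≈ n · h (suc zero)
    on-residues zero    = h-ε
    on-residues (suc n) = trans (reflexive (≡.cong h (suc-mod n)))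
                            (trans (h-∙ _ _) (∙-congˡ (on-residues n)))

  decompose : ∀ {r} (F : Vec (Fin m) r → Carrier) →
              (∀ v w → F (zipWith _+ₘ_ v w) ≈ F v ∙ F w) → F (replicate r zero) ≈ ε →
              ∀ v → F v ≈ lin (coords v) (map F (basis r))
  decompose F F-∙ F-ε []      = F-ε
  decompose {suc r} F F-∙ F-ε (a ∷ v) = begin
    F (a ∷ v)                                       ≡⟨ ≡.cong F split ⟨
    F (zipWith _+ₘ_ (a ∷ 0s) (zero ∷ v))            ≈⟨ F-∙ _ _ ⟩
    F (a ∷ 0s) ∙ F (zero ∷ v)                       ≈⟨ ∙-cong head tail ⟩
    toℕ a · F (suc zero ∷ 0s) ∙ lin (coords v) (map (F ∘ (zero ∷_)) (basis r))
      ≡⟨ ≡.cong (λ bs → toℕ a · F (suc zero ∷ 0s) ∙ lin (coords v) bs) (map-∘ F (zero ∷_) (basis r)) ⟩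
    lin (coords (a ∷ v)) (map F (basis (suc r)))    ∎
    where
    open ≈-Reasoning
    0s : Vec (Fin m) r
    0s = replicate r zero
    split : zipWith _+ₘ_ (a ∷ 0s) (zero ∷ v) ≡.≡ a ∷ v
    split = ≡.cong₂ _∷_ (+ₘ-identityʳ a) (zeros-+ v)
    head : F (a ∷ 0s) ≈ toℕ a · F (suc zero ∷ 0s)
    head = cyclic-hom (λ b → F (b ∷ 0s))
             (λ b c → trans (reflexive (≡.cong (λ w → F (_ ∷ w)) (≡.sym (zeros-+ 0s)))) (F-∙ _ _))
             F-ε a
    tail : F (zero ∷ v) ≈ lin (coords v) (map (F ∘ (zero ∷_)) (basis r))
    tail = decompose (F ∘ (zero ∷_)) (λ w w′ → F-∙ (zero ∷ w) (zero ∷ w′)) F-ε v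

  family : ∀ {r} → HasZmPowSubgroup G m r → Vec Carrier r
  family {r} (F , _) = map F (basis r)

  family-spans : ∀ {r} (emb : HasZmPowSubgroup G m r) v →
                 proj₁ emb v ≈ lin (coords v) (family emb)
  family-spans (F , mono) = decompose F ∙-homo ε-homo
    where open IsGroupMonomorphism mono

  family-free : ∀ {r} (emb : HasZmPowSubgroup G m r) → Free (family emb)
  family-free {r} (F , mono) xs relation = residues-vanish xs (injective (begin
      F (residues xs)                                 ≈⟨ family-spans (F , mono) (residues xs) ⟩
      lin (coords (residues xs)) (family (F , mono))  ≈⟨ lin-≡ₘ _ (coords-residues xs) ⟩
      lin xs (family (F , mono))                      ≈⟨ relation ⟩
      ε                                               ≈⟨ ε-homo ⟨
      F (replicate r zero)                            ∎))
    where
    open ≈-Reasoning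
    open IsGroupMonomorphism mono
    residues : ∀ {s} → Vec ℕ s → Vec (Fin m) s
    residues = map (_mod m)
    coords-residues : ∀ {s} (ys : Vec ℕ s) → Pointwise _≡ₘ_ (coords (residues ys)) ys
    coords-residues []       = []
    coords-residues (y ∷ ys) = toℕ-mod y ∷ coords-residues ys
    residues-vanish : ∀ {s} (ys : Vec ℕ s) → residues ys ≡.≡ replicate s zero → Null ys
    residues-vanish []       _  = []
    residues-vanish (y ∷ ys) eq =
      ≡ₘ-trans (≡ₘ-sym (toℕ-mod y)) (≡⇒≡ₘ (≡.cong toℕ (∷-injectiveˡ eq))) ∷ residues-vanish ys (∷-injectiveʳ eq)

  free⇒embedding : ∀ {r} (bs : Vec Carrier r) → Free bs → HasZmPowSubgroup G m r
  free⇒embedding {r} bs free = F , record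
    { isGroupHomomorphism = record
      { isMonoidHomomorphism = record
        { isMagmaHomomorphism = record
          { isRelHomomorphism = record { cong = reflexive ∘ ≡.cong F }
          ; homo = F-∙ }
        ; ε-homo = trans (reflexive (≡.cong (λ xs → lin xs bs) (coords-0 r))) (lin-zeros bs) }
      ; ⁻¹-homo = F-⁻¹ }
    ; injective = F-injective }
    where
    F : Vec (Fin m) r → Carrier
    F v = lin (coords v) bs
    F-∙ : ∀ v w → F (zipWith _+ₘ_ v w) ≈ F v ∙ F w
    F-∙ v w = trans (lin-≡ₘ bs (coords-+ v w)) (lin-+ (coords v) (coords w) bs)
    F-⁻¹ : ∀ v → F (map -ₘ_ v) ≈ F v ⁻¹
    F-⁻¹ v = GroupProperties.inverseˡ-unique _ _ (begin
      F (map -ₘ_ v) ∙ F v                                ≈⟨ lin-+ (coords (map -ₘ_ v)) (coords v) bs ⟨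
      lin (zipWith _+_ (coords (map -ₘ_ v)) (coords v)) bs ≈⟨ lin-≡ₘ bs (coords-neg v) ⟩
      lin (zeros r) bs                                   ≈⟨ lin-zeros bs ⟩
      ε                                                  ∎)
      where open ≈-Reasoning
    -- F v ≈ F w makes coords v − coords w a relation, hence null.
    F-injective : ∀ {v w} → F v ≈ F w → v ≡.≡ w
    F-injective {v} {w} e = coords-injective v w (differences (coords v) (coords w) (free _ (begin
      lin (zipWith _+_ (coords v) (map (m-1 *_) (coords w))) bs ≈⟨ lin-+ (coords v) _ bs ⟩
      F v ∙ lin (map (m-1 *_) (coords w)) bs   ≈⟨ ∙-cong e (lin-* m-1 (coords w) bs) ⟩
      F w ∙ m-1 · F w                          ≈⟨ comm _ _ ⟩
      m-1 · F w ∙ F w                          ≈⟨ m-1·x∙x≈ε (F w) ⟩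
      ε                                        ∎)))
      where
      open ≈-Reasoning
      differences : ∀ {s} (xs ys : Vec ℕ s) → Null (zipWith _+_ xs (map (m-1 *_) ys)) →
                    Pointwise _≡ₘ_ xs ys
      differences []       []       []       = []
      differences (x ∷ xs) (y ∷ ys) (n ∷ ns) = difference-≡ₘ0 n ∷ differences xs ys ns

-- 2×2 matrices over ℤ/m that are injective on (ℤ/m)² and whose second row
-- annihilates a given pair (c₀, c₁).  They are built from Bézout's identity
-- for the cofactors of c₀ and c₁ by their gcd.
module KillingMatrices (k : ℕ) where
  open import Data.Nat
  open import Data.Nat.Properties using (_≟_; *-assoc; *-identityʳ)
  open import Data.Nat.DivMod using (_/_; m/n*n≡m)
  open import Data.Nat.GCD using (gcd; gcd[m,n]∣m; gcd[m,n]∣n; gcd[m,n]≡0⇒m≡0; gcd[m,n]≡0⇒n≡0; module Bézout)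
  open import Data.Nat.Coprimality using (coprime-/gcd; coprime-Bézout)
  open import Data.Nat.Tactic.RingSolver using (solve-∀)
  open import Relation.Binary.PropositionalEquality

  open Congruence k
  open ≡ₘ-Reasoning

  record Cofactors (c₀ c₁ : ℕ) : Set where
    field
      a b d u v  : ℕ
      c₀≡a*d     : c₀ ≡ a * d
      c₁≡b*d     : c₁ ≡ b * d
      unimodular : u * a + v * b ≡ₘ 1

  ≡1+⇒≡ₘ1 : ∀ {s t} → s ≡ 1 + t → s + m-1 * t ≡ₘ 1
  ≡1+⇒≡ₘ1 {s} {t} refl = ≡ₘ-via 1 t (unfold k t)
    where
    unfold : ∀ j t → (1 + t) + suc j * t ≡ 1 + t * suc (suc j)
    unfold = solve-∀

  cofactors : ∀ c₀ c₁ → Cofactors c₀ c₁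
  cofactors c₀ c₁ with gcd c₀ c₁ ≟ 0
  ... | yes g≡0 = record
    { a = 1 ; b = 0 ; d = 0 ; u = 1 ; v = 0
    ; c₀≡a*d = gcd[m,n]≡0⇒m≡0 g≡0 ; c₁≡b*d = gcd[m,n]≡0⇒n≡0 c₀ g≡0 ; unimodular = ≡ₘ-refl }
  ... | no g≢0 = from-bézout (coprime-Bézout (coprime-/gcd c₀ c₁))
    where
    instance
      gcd≢0 : NonZero (gcd c₀ c₁)
      gcd≢0 = ≢-nonZero g≢0
    a = c₀ / gcd c₀ c₁
    b = c₁ / gcd c₀ c₁
    from-bézout : Bézout.Identity 1 a b → Cofactors c₀ c₁
    from-bézout (Bézout.+- x y eq) = record
      { a = a ; b = b ; d = gcd c₀ c₁ ; u = x ; v = m-1 * y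
      ; c₀≡a*d = sym (m/n*n≡m (gcd[m,n]∣m c₀ c₁)) ; c₁≡b*d = sym (m/n*n≡m (gcd[m,n]∣n c₀ c₁))
      ; unimodular = ≡ₘ-trans (≡⇒≡ₘ (cong (x * a +_) (*-assoc m-1 y b))) (≡1+⇒≡ₘ1 (sym eq)) }
    from-bézout (Bézout.-+ x y eq) = record
      { a = a ; b = b ; d = gcd c₀ c₁ ; u = m-1 * x ; v = y
      ; c₀≡a*d = sym (m/n*n≡m (gcd[m,n]∣m c₀ c₁)) ; c₁≡b*d = sym (m/n*n≡m (gcd[m,n]∣n c₀ c₁))
      ; unimodular = ≡ₘ-trans (≡⇒≡ₘ (trans (cong (_+ y * b) (*-assoc m-1 x a)) (+-comm _ (y * b))))
                       (≡1+⇒≡ₘ1 (sym eq)) }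

  -- The matrix with rows (u, v) and (p, q).
  record KillingMatrix (c₀ c₁ : ℕ) : Set where
    field
      u v p q   : ℕ
      kills     : p * c₀ + q * c₁ ≡ₘ 0
      injective : ∀ x₀ x₁ → x₀ * u + x₁ * p ≡ₘ 0 → x₀ * v + x₁ * q ≡ₘ 0 → x₀ ≡ₘ 0 × x₁ ≡ₘ 0

  -- With u·a + v·b ≡ 1, the rows (u, v) and (b, −a) form an invertible
  -- matrix whose inverse has rows (a, b) and (v, −u).
  killing-matrix : ∀ c₀ c₁ → KillingMatrix c₀ c₁
  killing-matrix c₀ c₁ = record
    { u = u ; v = v ; p = b ; q = m-1 * a
    ; kills = subst₂ (λ c c′ → b * c + m-1 * a * c′ ≡ₘ 0) (sym c₀≡a*d) (sym c₁≡b*d)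
                (≡ₘ-via 0 (a * b * d) (kill-identity k a b d))
    ; injective = λ x₀ x₁ s≡0 t≡0 →
        recover x₀ (x₁ * a * b) (first-row k a b u v x₀ x₁) (combination-null a b s≡0 t≡0)
      , recover x₁ (x₀ * u * v + x₁ * u * a * k) (second-row k a b u v x₀ x₁)
          (combination-null v (m-1 * u) s≡0 t≡0) }
    where
    open Cofactors (cofactors c₀ c₁)
    recover : ∀ x {e} n → e ≡ x * (u * a + v * b) + n * m → e ≡ₘ 0 → x ≡ₘ 0
    recover x {e} n e≡ e≡0 = begin
      x                               ≡⟨ *-identityʳ x ⟨
      x * 1                           ≈⟨ ≡ₘ-* (≡ₘ-refl {x}) unimodular ⟨
      x * (u * a + v * b)             ≈⟨ +-multiple _ n ⟨
      x * (u * a + v * b) + n * m     ≡⟨ e≡ ⟨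
      e                               ≈⟨ e≡0 ⟩
      0                               ∎
    kill-identity : ∀ j a b d → b * (a * d) + suc j * a * (b * d) ≡ 0 + (a * b * d) * suc (suc j)
    kill-identity = solve-∀
    first-row : ∀ j a b u v x₀ x₁ →
      a * (x₀ * u + x₁ * b) + b * (x₀ * v + x₁ * (suc j * a))
        ≡ x₀ * (u * a + v * b) + (x₁ * a * b) * suc (suc j)
    first-row = solve-∀
    second-row : ∀ j a b u v x₀ x₁ →
      v * (x₀ * u + x₁ * b) + suc j * u * (x₀ * v + x₁ * (suc j * a))
        ≡ x₁ * (u * a + v * b) + (x₀ * u * v + x₁ * u * a * j) * suc (suc j)
    second-row = solve-∀

-- One functional F is handled by sweeping along the family with killing
-- matrices for pairs (F b₀, F b₁): each step moves one element into Ker F.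
module KernelReduction (k : ℕ) (G : AbelianGroup 0ℓ 0ℓ) (tor : IsTorsion G (Congruence.m k)) where
  open import Data.Nat
  open import Data.Fin using (zero; suc)
  open import Data.Vec.Relation.Unary.All.Properties using (++ˡ⁻)
  import Relation.Binary.PropositionalEquality as ≡

  open Congruence k
  open KillingMatrices k
  open TorsionGroup k G tor
  open import Algebra.Solver.CommutativeMonoid commutativeMonoid using (solve; _⊕_; _⊜_)

  self-span : ∀ {r} (bs : Vec Carrier r) → All (InSpan bs) bs
  self-span []       = []
  self-span (b ∷ bs) = (1 ∷ zeros _ , trans (∙-cong (identityʳ b) (lin-zeros bs)) (identityʳ b))
    ∷ All.map (λ { (ys , e) → 0 ∷ ys , trans (identityˡ _) e }) (self-span bs)

  free-tail : ∀ {r} b (bs : Vec Carrier r) → Free (b ∷ bs) → Free bs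
  free-tail b bs free xs rel with free (0 ∷ xs) (trans (identityˡ _) rel)
  ... | _ ∷ null = null

  free-swap : ∀ {r} a b (bs : Vec Carrier r) → Free (a ∷ b ∷ bs) → Free (b ∷ a ∷ bs)
  free-swap a b bs free (x ∷ y ∷ xs) rel with free (y ∷ x ∷ xs) (trans (x∙yz≈y∙xz _ _ _) rel)
  ... | ny ∷ nx ∷ n = nx ∷ ny ∷ n

  replace-free : ∀ {r s t} (as : Vec Carrier r) (cs : Vec Carrier s) (ds : Vec Carrier t) →
                 Free (as ++ cs) → Free ds → All (InSpan cs) ds → Free (as ++ ds)
  replace-free {r} {s} as cs ds free-ac free-d ds⊆cs ws rel with splitAt r ws
  ... | xs , zs , ≡.refl = ++⁺ xs-null (free-d zs zs-rel)
    where
    zs-span : InSpan cs (lin zs ds)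
    zs-span = ∈-lin (span-subgroup cs) zs ds⊆cs
    ys : Vec ℕ s
    ys = proj₁ zs-span
    rel′ : lin xs as ∙ lin zs ds ≈ ε
    rel′ = trans (sym (lin-++ xs zs as ds)) rel
    xys-null : Null (xs ++ ys)
    xys-null = free-ac (xs ++ ys) (trans (lin-++ xs ys as cs) (trans (∙-congˡ (proj₂ zs-span)) rel′))
    xs-null : Null xs
    xs-null = ++ˡ⁻ xs xys-null
    zs-rel : lin zs ds ≈ ε
    zs-rel = trans (sym (identityˡ _)) (trans (∙-congʳ (sym (lin-null xs as xs-null))) rel′)

  module Move {c₀ c₁} (M : KillingMatrix c₀ c₁) (b₀ b₁ : Carrier) where
    open KillingMatrix M

    b₀′ b₁′ : Carrier
    b₀′ = u · b₀ ∙ v · b₁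
    b₁′ = p · b₀ ∙ q · b₁

    move-pres : ∀ {r} (rest : Vec Carrier r) → Pres (b₀ ∷ b₁ ∷ rest) (b₀′ ∷ b₁′ ∷ rest)
    move-pres rest Q Q-sub (q₀ ∷ q₁ ∷ qs) =
      ∈-∙ Q-sub (∈-· Q-sub u q₀) (∈-· Q-sub v q₁) ∷ ∈-∙ Q-sub (∈-· Q-sub p q₀) (∈-· Q-sub q q₁) ∷ qs

    distribute : ∀ x y w → x · (y · b₀ ∙ w · b₁) ≈ (x * y) · b₀ ∙ (x * w) · b₁
    distribute x y w = trans (·-∙ x _ _) (∙-cong (·-* x y b₀) (·-* x w b₁))

    expand : ∀ {r} x₀ x₁ (xs : Vec ℕ r) rest →
             lin (x₀ ∷ x₁ ∷ xs) (b₀′ ∷ b₁′ ∷ rest)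
               ≈ lin ((x₀ * u + x₁ * p) ∷ (x₀ * v + x₁ * q) ∷ xs) (b₀ ∷ b₁ ∷ rest)
    expand x₀ x₁ xs rest = begin
      x₀ · b₀′ ∙ (x₁ · b₁′ ∙ lin xs rest)
        ≈⟨ ∙-cong (distribute x₀ u v) (∙-congʳ (distribute x₁ p q)) ⟩
      ((x₀ * u) · b₀ ∙ (x₀ * v) · b₁) ∙ (((x₁ * p) · b₀ ∙ (x₁ * q) · b₁) ∙ lin xs rest)
        ≈⟨ solve 5 (λ a b c d l → (a ⊕ b) ⊕ ((c ⊕ d) ⊕ l) ⊜ (a ⊕ c) ⊕ ((b ⊕ d) ⊕ l))
             refl _ _ _ _ _ ⟩
      ((x₀ * u) · b₀ ∙ (x₁ * p) · b₀) ∙ (((x₀ * v) · b₁ ∙ (x₁ * q) · b₁) ∙ lin xs rest)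
        ≈⟨ ∙-cong (·-+ (x₀ * u) (x₁ * p) b₀) (∙-congʳ (·-+ (x₀ * v) (x₁ * q) b₁)) ⟨
      (x₀ * u + x₁ * p) · b₀ ∙ ((x₀ * v + x₁ * q) · b₁ ∙ lin xs rest) ∎
      where open ≈-Reasoning

    -- Since the matrix is injective, freeness is preserved.
    move-free : ∀ {r} (rest : Vec Carrier r) → Free (b₀ ∷ b₁ ∷ rest) → Free (b₀′ ∷ b₁′ ∷ rest)
    move-free rest free (x₀ ∷ x₁ ∷ xs) rel
      with free ((x₀ * u + x₁ * p) ∷ (x₀ * v + x₁ * q) ∷ xs) (trans (sym (expand x₀ x₁ xs rest)) rel)
    ... | n₀ ∷ n₁ ∷ ns = proj₁ (injective x₀ x₁ n₀ n₁) ∷ proj₂ (injective x₀ x₁ n₀ n₁) ∷ ns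

  Reduction : (Carrier → Set) → ∀ {s} → Vec Carrier s → ℕ → Set₁
  Reduction P bs t = Σ (Vec Carrier t) λ ds → Free ds × All P ds × Pres bs ds

  module _ (F : Functional) where
    open Functional F

    kernel-step : ∀ {t} (bs : Vec Carrier (suc t)) → Free bs → Reduction (Ker F) bs t
    kernel-step {zero}  (b ∷ [])          _    = [] , (λ { [] _ → [] }) , [] , (λ _ _ _ → [])
    kernel-step {suc t} (b₀ ∷ b₁ ∷ rest) free =
      b₁′ ∷ ds , free′ , b₁′-ker ∷ ds-ker , pres′
      where
      M : KillingMatrix (ap b₀) (ap b₁)
      M = killing-matrix (ap b₀) (ap b₁)
      open Move M b₀ b₁
      open KillingMatrix M using (p; q; kills)
      swapped : Free (b₁′ ∷ b₀′ ∷ rest)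
      swapped = free-swap b₀′ b₁′ rest (move-free rest free)
      reduced : Reduction (Ker F) (b₀′ ∷ rest) t
      reduced = kernel-step (b₀′ ∷ rest) (free-tail b₁′ (b₀′ ∷ rest) swapped)
      ds : Vec Carrier t
      ds = proj₁ reduced
      ds-free : Free ds
      ds-free = proj₁ (proj₂ reduced)
      ds-ker : All (Ker F) ds
      ds-ker = proj₁ (proj₂ (proj₂ reduced))
      ds-pres : Pres (b₀′ ∷ rest) ds
      ds-pres = proj₂ (proj₂ (proj₂ reduced))
      b₁′-ker : Ker F b₁′
      b₁′-ker = ≡ₘ-trans (ap-∙ _ _) (≡ₘ-trans (≡ₘ-+ (ap-· F p b₀) (ap-· F q b₁)) kills)
      free′ : Free (b₁′ ∷ ds)
      free′ = replace-free (b₁′ ∷ []) (b₀′ ∷ rest) ds swapped ds-free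
                (ds-pres (InSpan (b₀′ ∷ rest)) (span-subgroup _) (self-span _))
      pres′ : Pres (b₀ ∷ b₁ ∷ rest) (b₁′ ∷ ds)
      pres′ Q Q-sub qs with move-pres rest Q Q-sub qs
      ... | q₀ ∷ q₁ ∷ qr = q₁ ∷ ds-pres Q Q-sub (q₀ ∷ qr)

  kernel-reduction : ∀ {n s} (Fs : Fin n → Functional) (bs : Vec Carrier s) → Free bs →
                     Reduction (λ d → ∀ j → Ker (Fs j) d) bs (s ∸ n)
  kernel-reduction {zero}  Fs bs free = bs , free , All.universal (λ _ ()) bs , λ _ _ qs → qs
  kernel-reduction {suc n} Fs [] free = [] , (λ { [] _ → [] }) , [] , (λ _ _ _ → [])
  kernel-reduction {suc n} Fs (b ∷ bs) free
    with kernel-step (Fs zero) (b ∷ bs) free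
  ... | ds₁ , ds₁-free , ds₁-ker , ds₁-pres
    with kernel-reduction (λ j → Fs (suc j)) ds₁ ds₁-free
  ... | ds , ds-free , ds-ker , ds-pres =
    ds , ds-free , All.map (λ { (k₀ , ks) → kill-all k₀ ks })
                       (All.zip (ds-pres (Ker (Fs zero)) (ker-subgroup (Fs zero)) ds₁-ker , ds-ker))
       , λ Q Q-sub qs → ds-pres Q Q-sub (ds₁-pres Q Q-sub qs)
    where
    kill-all : ∀ {d} → Ker (Fs zero) d → (∀ j → Ker (Fs (suc j)) d) → ∀ j → Ker (Fs j) d
    kill-all k₀ ks zero    = k₀
    kill-all k₀ ks (suc j) = ks j

bounded-search : {Q : ℕ → Set} → (∀ n → Dec (Q n)) → ∀ M →
                 (Σ ℕ λ n → n < M × Q n × (∀ j → j < n → ¬ Q j)) ⊎ (∀ j → j < M → ¬ Q j)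
bounded-search Q? zero = inj₂ (λ j ())
bounded-search {Q} Q? (suc M) with bounded-search Q? M
... | inj₁ (n , n<M , qn , minimal) = inj₁ (n , m≤n⇒m≤1+n n<M , qn , minimal)
... | inj₂ none with Q? M
...   | yes qM = inj₁ (M , ≤-refl , qM , none)
...   | no ¬qM = inj₂ below
  where
  open import Relation.Binary.PropositionalEquality using (refl)
  below : ∀ j → j < suc M → ¬ Q j
  below j j<1+M with m<1+n⇒m<n∨m≡n j<1+M
  ... | inj₁ j<M  = none j j<M
  ... | inj₂ refl = ¬qM

least-witness : {Q : ℕ → Set} → (∀ n → Dec (Q n)) → ∀ N → Q N →
                Σ ℕ λ n → Q n × (∀ j → j < n → ¬ Q j)
least-witness Q? N qN with bounded-search Q? N
... | inj₁ (n , _ , qn , minimal) = n , qn , minimal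
... | inj₂ none                   = N , qN , none

-- Extension of functionals (ℤ/m is an injective ℤ/m-module): a functional
-- defined on a decidable subgroup of a finite group G extends to all of G.
-- One element x is adjoined at a time; the value at x must be compatible with
-- the multiples of x already in the domain, and such a value exists because
-- the multiples of x in the domain are those of d·x for the least such d > 0.
module FunctionalExtension (k : ℕ) (G : AbelianGroup 0ℓ 0ℓ) (tor : IsTorsion G (Congruence.m k)) where
  open import Data.Nat
  open import Data.Nat.Properties using (m+[n∸m]≡n; m∸n+n≡m; <⇒≤; ≤-pred; *-comm; *-assoc; +-identityʳ)
  open import Data.Nat.DivMod using (_mod_; m%n<n; m≡m%n+[m/n]*n; m*[n/m]≡n)
  open import Data.Nat.Divisibility using (_∣_; divides; m%n≡0⇒n∣m; *-cancelˡ-∣)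
  open import Data.Nat.Tactic.RingSolver using (solve-∀)
  open import Data.Fin using (toℕ; zero; suc)
  open import Data.Fin.Properties using (toℕ<n; any?)
  open import Data.Empty using (⊥-elim)
  import Relation.Binary.PropositionalEquality as ≡
  open ≡ using (_≡_)

  open Congruence k
  open ZmVectors k using (toℕ-mod)
  open TorsionGroup k G tor

  record PartialFunctional : Set₁ where
    field
      Dom      : Carrier → Set
      dom?     : ∀ x → Dec (Dom x)
      dom-sub  : Subgroup Dom
      val      : Carrier → ℕ
      val-cong : ∀ {x y} → Dom x → x ≈ y → val x ≡ₘ val y
      val-∙    : ∀ {x y} → Dom x → Dom y → val (x ∙ y) ≡ₘ val x + val y

    open AdditiveOn dom-sub val val-cong val-∙ public
      renaming (φ-ε to val-ε; φ-· to val-·)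

  open PartialFunctional

  record _⊑_ (pf pf′ : PartialFunctional) : Set where
    field
      dom-⊆  : ∀ {s} → Dom pf s → Dom pf′ s
      agrees : ∀ {s} → Dom pf s → val pf′ s ≡ₘ val pf s

  open _⊑_

  ⊑-refl : ∀ {pf} → pf ⊑ pf
  ⊑-refl = record { dom-⊆ = λ s → s ; agrees = λ _ → ≡ₘ-refl }

  ⊑-trans : ∀ {pf pf′ pf″} → pf ⊑ pf′ → pf′ ⊑ pf″ → pf ⊑ pf″
  ⊑-trans e e′ = record
    { dom-⊆  = λ s → dom-⊆ e′ (dom-⊆ e s)
    ; agrees = λ s → ≡ₘ-trans (agrees e′ (dom-⊆ e s)) (agrees e s) }

  ∙-multiples : ∀ s n j x → (s ∙ n · x) ∙ j · x ≈ s ∙ (n + j) · x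
  ∙-multiples s n j x = trans (assoc _ _ _) (∙-congˡ (sym (·-+ n j x)))

  -- Adjoining x to the domain, with value v at x.  The new domain consists of
  -- the y with y + j·x in the old one for some j < m, i.e. the y ≈ s ∙ n·x.
  module Adjoin (pf : PartialFunctional) (x : Carrier) (v : ℕ)
                (compatible : ∀ n → Dom pf (n · x) → val pf (n · x) ≡ₘ n * v) where
    private
      S : Carrier → Set
      S = Dom pf
      λ₀ : Carrier → ℕ
      λ₀ = val pf
      S-sub : Subgroup S
      S-sub = dom-sub pf

    Dom′ : Carrier → Set
    Dom′ y = Σ (Fin m) λ j → S (y ∙ toℕ j · x)

    dom′? : ∀ y → Dec (Dom′ y)
    dom′? y = any? (λ j → dom? pf (y ∙ toℕ j · x))

    val′ : Carrier → ℕ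
    val′ y with dom′? y
    ... | yes (j , _) = λ₀ (y ∙ toℕ j · x) + (m ∸ toℕ j) * v
    ... | no _        = 0

    Decomposed : Carrier → Set
    Decomposed y = Σ Carrier λ s → Σ ℕ λ n → S s × y ≈ s ∙ n · x

    decomposed⇒dom′ : ∀ {y} → Decomposed y → Dom′ y
    decomposed⇒dom′ {y} (s , n , ss , y≈) = j , ∈-≈ S-sub (sym y+jx≈s) ss
      where
      j : Fin m
      j = (m-1 * n) mod m
      n+j≡0 : n + toℕ j ≡ₘ 0
      n+j≡0 = ≡ₘ-trans (≡ₘ-+ (≡ₘ-refl {n}) (toℕ-mod (m-1 * n))) (≡ₘ-via 0 n (times-m k n))
        where
        times-m : ∀ i n → n + suc i * n ≡ 0 + n * suc (suc i)
        times-m = solve-∀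
      y+jx≈s : y ∙ toℕ j · x ≈ s
      y+jx≈s = trans (∙-congʳ y≈) (trans (∙-multiples s n (toℕ j) x)
                 (trans (∙-congˡ (·-≡ₘ x n+j≡0)) (identityʳ s)))

    dom′⇒decomposed : ∀ {y} → Dom′ y → Decomposed y
    dom′⇒decomposed {y} (j , sj) = y ∙ toℕ j · x , m ∸ toℕ j , sj , sym (begin
      (y ∙ toℕ j · x) ∙ (m ∸ toℕ j) · x   ≈⟨ ∙-multiples y (toℕ j) (m ∸ toℕ j) x ⟩
      y ∙ (toℕ j + (m ∸ toℕ j)) · x       ≡⟨ ≡.cong (λ n → y ∙ n · x) (m+[n∸m]≡n (<⇒≤ (toℕ<n j))) ⟩
      y ∙ m · x                           ≈⟨ ∙-congˡ (tor x) ⟩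
      y ∙ ε                               ≈⟨ identityʳ y ⟩
      y                                   ∎)
      where open ≈-Reasoning

    val′-spec : ∀ {s} n {y} → S s → y ≈ s ∙ n · x → val′ y ≡ₘ λ₀ s + n * v
    val′-spec {s} n {y} ss y≈ with dom′? y
    ... | no ¬dom = ⊥-elim (¬dom (decomposed⇒dom′ (s , n , ss , y≈)))
    ... | yes (j , sj) = begin
      λ₀ (y ∙ J · x) + (m ∸ J) * v            ≈⟨ ≡ₘ-+ at-y+Jx (≡ₘ-refl {(m ∸ J) * v}) ⟩
      λ₀ s + (n + J) * v + (m ∸ J) * v        ≡⟨ regroup (λ₀ s) n J (m ∸ J) v ⟩
      λ₀ s + n * v + (m ∸ J + J) * v          ≡⟨ ≡.cong (λ t → λ₀ s + n * v + t * v) (m∸n+n≡m (<⇒≤ (toℕ<n j))) ⟩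
      λ₀ s + n * v + m * v                    ≡⟨ ≡.cong (λ₀ s + n * v +_) (*-comm m v) ⟩
      λ₀ s + n * v + v * m                    ≈⟨ +-multiple (λ₀ s + n * v) v ⟩
      λ₀ s + n * v                            ∎
      where
      open ≡ₘ-Reasoning
      J : ℕ
      J = toℕ j
      regroup : ∀ l n j w v → l + (n + j) * v + w * v ≡ l + n * v + (w + j) * v
      regroup = solve-∀
      y+Jx≈ : y ∙ J · x ≈ s ∙ (n + J) · x
      y+Jx≈ = trans (∙-congʳ y≈) (∙-multiples s n J x)
      multiple-in : S ((n + J) · x)
      multiple-in = ∈-cancelˡ S-sub (∈-≈ S-sub y+Jx≈ sj) ss
      at-y+Jx : λ₀ (y ∙ J · x) ≡ₘ λ₀ s + (n + J) * v
      at-y+Jx = ≡ₘ-trans (val-cong pf sj y+Jx≈)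
                  (≡ₘ-trans (val-∙ pf ss multiple-in) (≡ₘ-+ (≡ₘ-refl {λ₀ s}) (compatible (n + J) multiple-in)))

    sum-decomposed : ∀ {y₁ y₂} → Decomposed y₁ → Decomposed y₂ → Decomposed (y₁ ∙ y₂)
    sum-decomposed (s₁ , n₁ , ss₁ , e₁) (s₂ , n₂ , ss₂ , e₂) =
      s₁ ∙ s₂ , n₁ + n₂ , ∈-∙ S-sub ss₁ ss₂ , (begin
        _ ∙ _                                   ≈⟨ ∙-cong e₁ e₂ ⟩
        (s₁ ∙ n₁ · x) ∙ (s₂ ∙ n₂ · x)           ≈⟨ interchange _ _ _ _ ⟩
        (s₁ ∙ s₂) ∙ (n₁ · x ∙ n₂ · x)           ≈⟨ ∙-congˡ (·-+ n₁ n₂ x) ⟨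
        (s₁ ∙ s₂) ∙ (n₁ + n₂) · x               ∎)
      where open ≈-Reasoning

    dom′-sub : Subgroup Dom′
    dom′-sub = record
      { ∈-ε = decomposed⇒dom′ (ε , 0 , ∈-ε S-sub , sym (identityʳ ε))
      ; ∈-∙ = λ p q → decomposed⇒dom′ (sum-decomposed (dom′⇒decomposed p) (dom′⇒decomposed q))
      ; ∈-≈ = λ { y≈y′ p → let (s , n , ss , e) = dom′⇒decomposed p
                           in decomposed⇒dom′ (s , n , ss , trans (sym y≈y′) e) } }

    extended : PartialFunctional
    extended = record
      { Dom = Dom′ ; dom? = dom′? ; dom-sub = dom′-sub ; val = val′
      ; val-cong = λ {y} {y′} p y≈y′ → let (s , n , ss , e) = dom′⇒decomposed p in
          ≡ₘ-trans (val′-spec n ss e) (≡ₘ-sym (val′-spec n ss (trans (sym y≈y′) e)))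
      ; val-∙ = λ {y₁} {y₂} p q →
          let d₁@(s₁ , n₁ , ss₁ , e₁) = dom′⇒decomposed p
              d₂@(s₂ , n₂ , ss₂ , e₂) = dom′⇒decomposed q
              (_ , _ , ss , e) = sum-decomposed d₁ d₂
          in ≡ₘ-trans (val′-spec (n₁ + n₂) ss e)
               (≡ₘ-trans (≡ₘ-+ (val-∙ pf ss₁ ss₂) (≡ₘ-refl {(n₁ + n₂) * v}))
               (≡ₘ-trans (≡⇒≡ₘ (regroup (λ₀ s₁) (λ₀ s₂) n₁ n₂ v))
                 (≡ₘ-sym (≡ₘ-+ (val′-spec n₁ ss₁ e₁) (val′-spec n₂ ss₂ e₂))))) }
      where
      regroup : ∀ a b n₁ n₂ v → (a + b) + (n₁ + n₂) * v ≡ (a + n₁ * v) + (b + n₂ * v)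
      regroup = solve-∀

    extends : pf ⊑ extended
    extends = record
      { dom-⊆  = λ ss → decomposed⇒dom′ (_ , 0 , ss , sym (identityʳ _))
      ; agrees = λ ss → ≡ₘ-trans (val′-spec 0 ss (sym (identityʳ _))) (≡⇒≡ₘ (+-identityʳ _)) }

    x∈ : Dom′ x
    x∈ = decomposed⇒dom′ (ε , 1 , ∈-ε S-sub , sym (trans (identityˡ _) (identityʳ x)))

  -- A value at x compatible with pf: with d the least positive number such
  -- that d·x lies in the domain, d divides m and the value w at d·x, and
  -- v = w / d satisfies c·x ↦ c·v on the domain.
  module CompatibleValue (pf : PartialFunctional) (x : Carrier) where
    private
      S : Carrier → Set
      S = Dom pf
      S-sub : Subgroup S
      S-sub = dom-sub pf

    m·x∈S : S (m · x)
    m·x∈S = ∈-≈ S-sub (sym (tor x)) (∈-ε S-sub)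

    least : Σ ℕ λ n → S (suc n · x) × (∀ j → j < n → ¬ S (suc j · x))
    least = least-witness (λ n → dom? pf (suc n · x)) m-1 m·x∈S

    d : ℕ
    d = suc (proj₁ least)

    d·x∈S : S (d · x)
    d·x∈S = proj₁ (proj₂ least)

    d∣ : ∀ c → S (c · x) → d ∣ c
    d∣ c c·x∈S with c % d in c%d≡
    ... | zero  = m%n≡0⇒n∣m c d c%d≡
    ... | suc r = ⊥-elim (proj₂ (proj₂ least) r r<n (≡.subst (λ t → S (t · x)) c%d≡ remainder∈S))
      where
      r<n : r < proj₁ least
      r<n = ≤-pred (≡.subst (_< d) c%d≡ (m%n<n c d))
      split : c · x ≈ (c % d) · x ∙ (c / d) · d · x
      split = trans (reflexive (≡.cong (_· x) (m≡m%n+[m/n]*n c d)))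
                (trans (·-+ (c % d) ((c / d) * d) x) (∙-congˡ (sym (·-* (c / d) d x))))
      remainder∈S : S ((c % d) · x)
      remainder∈S = ∈-cancelˡ S-sub (∈-≈ S-sub (trans split (comm _ _)) c·x∈S) (∈-· S-sub (c / d) d·x∈S)

    w : ℕ
    w = val pf (d · x)

    -- m = e·d and e·w ≡ val (m·x) ≡ 0, so m = e·d divides e·w.
    d∣w : d ∣ w
    d∣w with d∣ m m·x∈S
    ... | divides zero    ()
    ... | divides (suc e′) m≡ = *-cancelˡ-∣ e (≡.subst (_∣ e * w) m≡ m∣e*w)
      where
      e : ℕ
      e = suc e′
      e*w≡0 : e * w ≡ₘ 0
      e*w≡0 = ≡ₘ-trans (≡ₘ-sym (val-· pf e d·x∈S))
                (≡ₘ-trans (val-cong pf (∈-· S-sub e d·x∈S)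
                  (trans (·-* e d x) (trans (reflexive (≡.cong (_· x) (≡.sym m≡))) (tor x))))
                  (val-ε pf))
      m∣e*w : m ∣ e * w
      m∣e*w = ≡ₘ0⇒∣ e*w≡0

    v : ℕ
    v = w / d

    compatible : ∀ c → S (c · x) → val pf (c · x) ≡ₘ c * v
    compatible c c·x∈S with d∣ c c·x∈S
    ... | divides q c≡ = ≡ₘ-trans (val-cong pf c·x∈S (trans (reflexive (≡.cong (_· x) c≡)) (sym (·-* q d x))))
        (≡ₘ-trans (val-· pf q d·x∈S) (≡⇒≡ₘ (begin
          q * w           ≡⟨ ≡.cong (q *_) (m*[n/m]≡n d∣w) ⟨
          q * (d * v)     ≡⟨ *-assoc q d v ⟨
          q * d * v       ≡⟨ ≡.cong (_* v) c≡ ⟨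
          c * v           ∎)))
      where open ≡.≡-Reasoning

  adjoin : ∀ pf x → Σ PartialFunctional λ pf′ → pf ⊑ pf′ × Dom pf′ x
  adjoin pf x = Adjoin.extended pf x v compatible , Adjoin.extends pf x v compatible , Adjoin.x∈ pf x v compatible
    where open CompatibleValue pf x

  adjoin-all : ∀ pf N (xs : Fin N → Carrier) → Σ PartialFunctional λ pf′ → pf ⊑ pf′ × (∀ i → Dom pf′ (xs i))
  adjoin-all pf zero    xs = pf , ⊑-refl , λ ()
  adjoin-all pf (suc N) xs =
    let (pf₁ , pf⊑pf₁ , x₀∈) = adjoin pf (xs zero)
        (pf₂ , pf₁⊑pf₂ , rest∈) = adjoin-all pf₁ N (λ i → xs (suc i))
        all∈ : ∀ i → Dom pf₂ (xs i)
        all∈ = λ { zero → dom-⊆ pf₁⊑pf₂ x₀∈ ; (suc i) → rest∈ i }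
    in pf₂ , ⊑-trans pf⊑pf₁ pf₁⊑pf₂ , all∈

  extend : IsFinite G → (pf : PartialFunctional) →
           Σ Functional λ F → ∀ {s} → Dom pf s → Functional.ap F s ≡ₘ val pf s
  extend (N , enum , cover) pf = F , agrees pf⊑pf′
    where
    extended : Σ PartialFunctional λ pf′ → pf ⊑ pf′ × (∀ i → Dom pf′ (enum i))
    extended = adjoin-all pf N enum
    pf′ : PartialFunctional
    pf′ = proj₁ extended
    pf⊑pf′ : pf ⊑ pf′
    pf⊑pf′ = proj₁ (proj₂ extended)
    total : ∀ y → Dom pf′ y
    total y = ∈-≈ (dom-sub pf′) (proj₂ (cover y)) (proj₂ (proj₂ extended) (proj₁ (cover y)))
    F : Functional
    F = record { ap = val pf′ ; ap-cong = val-cong pf′ (total _)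
               ; ap-∙ = λ y z → val-∙ pf′ (total y) (total z) }

module Homomorphism (k : ℕ) (G H : AbelianGroup 0ℓ 0ℓ)
                    (torG : IsTorsion G (Congruence.m k)) (torH : IsTorsion H (Congruence.m k))
                    (h : AbelianGroup.Carrier G → AbelianGroup.Carrier H)
                    (h-hom : GroupMorphisms.IsGroupHomomorphism (AbelianGroup.rawGroup G) (AbelianGroup.rawGroup H) h) where
  open GroupMorphisms.IsGroupHomomorphism h-hom public using (⟦⟧-cong; ε-homo) renaming (homo to ∙-homo)
  open Congruence k using (≡ₘ-trans)
  private
    module G = TorsionGroup k G torG
    module H = TorsionGroup k H torH

  hom-· : ∀ n x → h (n G.· x) H.≈ n H.· h x
  hom-· zero    x = ε-homo
  hom-· (suc n) x = H.trans (∙-homo _ _) (H.∙-congˡ (hom-· n x))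

  hom-lin : ∀ {r} (xs : Vec ℕ r) bs → h (G.lin xs bs) H.≈ H.lin xs (map h bs)
  hom-lin []       []       = ε-homo
  hom-lin (x ∷ xs) (b ∷ bs) = H.trans (∙-homo _ _) (H.∙-cong (hom-· x b) (hom-lin xs bs))

  pullback : H.Functional → G.Functional
  pullback F = record
    { ap      = λ x → ap (h x)
    ; ap-cong = λ e → ap-cong (⟦⟧-cong e)
    ; ap-∙    = λ x y → ≡ₘ-trans (ap-cong (∙-homo x y)) (ap-∙ (h x) (h y)) }
    where open H.Functional F

module Coordinates (k : ℕ) (G : AbelianGroup 0ℓ 0ℓ) (tor : IsTorsion G (Congruence.m k))
                   {n : ℕ} (φ : Vec (Fin (Congruence.m k)) n → AbelianGroup.Carrier G)
                   (iso : GroupMorphisms.IsGroupIsomorphism (ZmPow (Congruence.m k) n)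
                                            (AbelianGroup.rawGroup G) φ) where
  open import Data.Fin using (toℕ; zero)
  open import Data.Vec using (lookup; zipWith; replicate)
  open import Data.Vec.Properties using (lookup-zipWith; lookup-replicate; tabulate∘lookup; tabulate-cong)
  import Relation.Binary.PropositionalEquality as ≡
  open GroupMorphisms.IsGroupIsomorphism iso

  open Congruence k
  open ZmVectors k
  open TorsionGroup k G tor

  ψ : Carrier → Vec (Fin m) n
  ψ c = proj₁ (surjective c)

  φψ : ∀ c → φ (ψ c) ≈ c
  φψ c = proj₂ (surjective c) ≡.refl

  ψ-cong : ∀ {c c′} → c ≈ c′ → ψ c ≡.≡ ψ c′
  ψ-cong {c} {c′} e = injective (trans (φψ c) (trans e (sym (φψ c′))))

  ψ-∙ : ∀ c c′ → ψ (c ∙ c′) ≡.≡ zipWith _+ₘ_ (ψ c) (ψ c′)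
  ψ-∙ c c′ = injective (trans (φψ _) (sym (trans (∙-homo (ψ c) (ψ c′)) (∙-cong (φψ c) (φψ c′)))))

  coordinate : Fin n → Functional
  coordinate j = record
    { ap      = λ c → toℕ (lookup (ψ c) j)
    ; ap-cong = λ e → ≡⇒≡ₘ (≡.cong (λ v → toℕ (lookup v j)) (ψ-cong e))
    ; ap-∙    = λ c c′ → ≡ₘ-trans
        (≡⇒≡ₘ (≡.cong toℕ (≡.trans (≡.cong (λ v → lookup v j) (ψ-∙ c c′)) (lookup-zipWith _+ₘ_ j (ψ c) (ψ c′)))))
        (toℕ-+ₘ (lookup (ψ c) j) (lookup (ψ c′) j)) }

  coordinates-vanish : ∀ {c} → (∀ j → Ker (coordinate j) c) → c ≈ ε
  coordinates-vanish {c} vanish = trans (sym (φψ c)) (trans (reflexive (≡.cong φ ψc≡0)) ε-homo)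
    where
    ψc≡0 : ψ c ≡.≡ replicate n zero
    ψc≡0 = ≡.trans (≡.sym (tabulate∘lookup (ψ c)))
             (≡.trans (tabulate-cong (λ j → ≡.trans (fin-≡ₘ⇒≡ (vanish j)) (≡.sym (lookup-replicate j zero))))
                      (tabulate∘lookup (replicate n zero)))

-- The domain is
-- decidable when A is finite and equality in B is decidable.
module ImageFunctional (k : ℕ) (A B : AbelianGroup 0ℓ 0ℓ)
                       (torA : IsTorsion A (Congruence.m k)) (torB : IsTorsion B (Congruence.m k))
                       (f : AbelianGroup.Carrier A → AbelianGroup.Carrier B)
                       (f-hom : GroupMorphisms.IsGroupHomomorphism (AbelianGroup.rawGroup A) (AbelianGroup.rawGroup B) f)
                       (f-injective : ∀ {x y} → AbelianGroup._≈_ B (f x) (f y) → AbelianGroup._≈_ A x y)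
                       (finA : IsFinite A)
                       (_≟_ : ∀ x y → Dec (AbelianGroup._≈_ B x y)) where
  open import Data.Fin.Properties using (any?)
  open import Data.Empty using (⊥-elim)
  open GroupMorphisms.IsGroupHomomorphism f-hom using (⟦⟧-cong; ε-homo) renaming (homo to ∙-homo)

  open Congruence k
  private
    module A = TorsionGroup k A torA
    module B = TorsionGroup k B torB
  open FunctionalExtension k B torB

  N : ℕ
  N = proj₁ finA
  enum : Fin N → A.Carrier
  enum = proj₁ (proj₂ finA)
  cover : ∀ a → Σ (Fin N) λ i → enum i A.≈ a
  cover = proj₂ (proj₂ finA)

  Image : B.Carrier → Set
  Image y = Σ (Fin N) λ i → f (enum i) B.≈ y

  image? : ∀ y → Dec (Image y)
  image? y = any? (λ i → f (enum i) ≟ y)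

  in-image : ∀ a → Image (f a)
  in-image a = proj₁ (cover a) , ⟦⟧-cong (proj₂ (cover a))

  image-sub : B.Subgroup Image
  image-sub = record
    { ∈-ε = let (i , e) = cover A.ε in i , B.trans (⟦⟧-cong e) ε-homo
    ; ∈-∙ = λ { (i , e) (j , e′) → let (l , e″) = cover (enum i A.∙ enum j)
                                   in l , B.trans (⟦⟧-cong e″) (B.trans (∙-homo _ _) (B.∙-cong e e′)) }
    ; ∈-≈ = λ { y≈y′ (i , e) → i , B.trans e y≈y′ } }

  module _ (c : A.Functional) where
    open A.Functional c

    transported : B.Carrier → ℕ
    transported y with image? y
    ... | yes (i , _) = ap (enum i)
    ... | no _        = 0

    transported-spec : ∀ {a y} → f a B.≈ y → transported y ≡ₘ ap a
    transported-spec {a} {y} fa≈y with image? y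
    ... | yes (i , e) = ap-cong (f-injective (B.trans e (B.sym fa≈y)))
    ... | no ¬image   = ⊥-elim (¬image (proj₁ (in-image a) , B.trans (proj₂ (in-image a)) fa≈y))

    image-functional : PartialFunctional
    image-functional = record
      { Dom = Image ; dom? = image? ; dom-sub = image-sub ; val = transported
      ; val-cong = λ { (i , e) y≈y′ → ≡ₘ-trans (transported-spec e) (≡ₘ-sym (transported-spec (B.trans e y≈y′))) }
      ; val-∙ = λ { (i , e) (j , e′) →
          ≡ₘ-trans (transported-spec (B.trans (∙-homo _ _) (B.∙-cong e e′)))
            (≡ₘ-trans (ap-∙ (enum i) (enum j))
              (≡ₘ-sym (≡ₘ-+ (transported-spec e) (transported-spec e′)))) } }

¬¬-finite-∀ : ∀ N {Q : Fin N → Set} → (∀ i → ¬ ¬ Q i) → ¬ ¬ (∀ i → Q i)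
¬¬-finite-∀ 0       ¬¬Q ¬all = ¬all (λ ())
¬¬-finite-∀ (suc N) ¬¬Q ¬all =
  ¬¬Q Fin.zero (λ q₀ → ¬¬-finite-∀ N (λ i → ¬¬Q (Fin.suc i))
                        (λ rest → ¬all (λ { Fin.zero → q₀ ; (Fin.suc i) → rest i })))

¬¬-decidable-≈ : (G : AbelianGroup 0ℓ 0ℓ) → IsFinite G →
                 ¬ ¬ (∀ x y → Dec (AbelianGroup._≈_ G x y))
¬¬-decidable-≈ G (N , enum , cover) ¬dec =
  ¬¬-finite-∀ N (λ i → ¬¬-finite-∀ N (λ j → ¬¬-excluded-middle)) (λ dec → ¬dec (on-all dec))
  where
  open AbelianGroup G
  open import Relation.Nullary.Decidable using (map′; ¬¬-excluded-middle)
  on-all : (∀ i j → Dec (enum i ≈ enum j)) → ∀ x y → Dec (x ≈ y)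
  on-all dec x y with cover x | cover y
  ... | i , eᵢ | j , eⱼ = map′ (λ p → trans (sym eᵢ) (trans p eⱼ)) (λ p → trans eᵢ (trans p (sym eⱼ))) (dec i j)

preimages : ∀ {X Y : Set} {_∼_ : Y → Y → Set} (h : X → Y) {r} {ys : Vec Y r} →
            All (λ y → Σ X λ x → h x ∼ y) ys → Σ (Vec X r) λ xs → Pointwise _∼_ (map h xs) ys
preimages h []              = [] , []
preimages h ((x , e) ∷ pre) = let (xs , es) = preimages h pre in x ∷ xs , e ∷ es

∸-bound : ∀ {r n a b} → n ≤ a → r ∸ n ≤ b → r ≤ a + b
∸-bound {r} {n} n≤a r∸n≤b = ≤-trans (m≤n+m∸n r n) (+-mono-≤ n≤a r∸n≤b)

module ShortExactRanks (k : ℕ) (A B C : AbelianGroup 0ℓ 0ℓ)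
                       (torA : IsTorsion A (Congruence.m k)) (torB : IsTorsion B (Congruence.m k))
                       (torC : IsTorsion C (Congruence.m k))
                       (f : AbelianGroup.Carrier A → AbelianGroup.Carrier B)
                       (g : AbelianGroup.Carrier B → AbelianGroup.Carrier C)
                       (exact : ShortExact A B C f g) where
  open import Relation.Binary.PropositionalEquality using (refl)
  open Congruence k
  open ShortExact exact
  private
    module A = TorsionGroup k A torA
    module B = TorsionGroup k B torB
    module C = TorsionGroup k C torC
    module FA = FreeFamilies k A torA
    module FB = FreeFamilies k B torB
    module FC = FreeFamilies k C torC
    module f = Homomorphism k A B torA torB f f-hom
    module g = Homomorphism k B C torB torC g g-hom

  -- A free family in A pushed along f, together with lifts of a free family
  -- of C, is free in B: so rk A + rk C ≤ rk B.
  lower-bound : ∀ {rA rB rC} → IsRank A m rA → IsRank B m rB → IsRank C m rC → rA + rC ≤ rB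
  lower-bound {rA} {rB} {rC} (hA , _) (_ , maxB) (hC , _) =
    maxB (rA + rC) (FB.free⇒embedding (map f α ++ β) free)
    where
    α : Vec A.Carrier rA
    α = FA.family hA
    γ : Vec C.Carrier rC
    γ = FC.family hC
    lifts : Σ (Vec B.Carrier rC) λ bs → Pointwise C._≈_ (map g bs) γ
    lifts = preimages g (All.universal g-surjective γ)
    β : Vec B.Carrier rC
    β = proj₁ lifts
    free : B.Free (map f α ++ β)
    free ws rel with splitAt rA ws
    ... | xs , ys , refl = ++⁺ xs-null ys-null
      where
      rel′ : f (A.lin xs α) B.∙ B.lin ys β B.≈ B.ε
      rel′ = B.trans (B.∙-congʳ (f.hom-lin xs α)) (B.trans (B.sym (B.lin-++ xs ys (map f α) β)) rel)
      -- g kills the image of f, so ys is a relation on γ.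
      γ-rel : C.lin ys γ C.≈ C.ε
      γ-rel = begin
        C.lin ys γ                          ≈⟨ C.lin-cong ys (proj₂ lifts) ⟨
        C.lin ys (map g β)                  ≈⟨ g.hom-lin ys β ⟨
        g (B.lin ys β)                      ≈⟨ C.identityˡ _ ⟨
        C.ε C.∙ g (B.lin ys β)              ≈⟨ C.∙-congʳ (im⊆ker _) ⟨
        g (f (A.lin xs α)) C.∙ g (B.lin ys β)
                                            ≈⟨ g.∙-homo _ _ ⟨
        g (f (A.lin xs α) B.∙ B.lin ys β)   ≈⟨ g.⟦⟧-cong rel′ ⟩
        g B.ε                               ≈⟨ g.ε-homo ⟩
        C.ε                                 ∎
        where open C.≈-Reasoning
      ys-null : C.Null ys
      ys-null = FC.family-free hC ys γ-rel
      -- then ys contributes ε, and xs is a relation on α by injectivity of f.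
      f-rel : f (A.lin xs α) B.≈ f A.ε
      f-rel = B.trans (B.sym (B.identityʳ _))
                (B.trans (B.∙-congˡ (B.sym (B.lin-null ys β ys-null))) (B.trans rel′ (B.sym f.ε-homo)))
      xs-null : A.Null xs
      xs-null = FA.family-free hA xs (f-injective f-rel)

  Killed : ∀ {n} → (Fin n → B.Functional) → ℕ → Set
  Killed Fs t = Σ (Vec B.Carrier t) λ ds → B.Free ds × All (λ d → ∀ j → B.Ker (Fs j) d) ds

  reduce : ∀ {rB n} → IsRank B m rB → (Fs : Fin n → B.Functional) → Killed Fs (rB ∸ n)
  reduce (hB , _) Fs =
    let (ds , ds-free , ds-ker , _) = kernel-reduction Fs (FB.family hB) (FB.family-free hB)
    in ds , ds-free , ds-ker
    where open KernelReduction k B torB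

  -- If C ≅ (ℤ/m)^n, kill the coordinates of g: the remaining free family lies
  -- in ker g = im f and lifts to a free family of A.  So rk B ≤ rk A + n.
  upper-bound-C : ∀ {n} (φ : Vec (Fin m) n → C.Carrier) →
                  IsGroupIsomorphism (ZmPow m n) C.rawGroup φ →
                  ∀ {rA rB rC} → IsRank A m rA → IsRank B m rB → IsRank C m rC → rB ≤ rA + rC
  upper-bound-C {n} φ iso {rA} {rB} (_ , maxA) hB (_ , maxC) =
    ≤-trans (∸-bound (maxC n (φ , isGroupMonomorphism)) (maxA (rB ∸ n) (FA.free⇒embedding as as-free)))
            (≤-reflexive (+-comm _ rA))
    where
    open IsGroupIsomorphism iso using (isGroupMonomorphism)
    open Coordinates k C torC φ iso
    Fs : Fin n → B.Functional
    Fs j = g.pullback (coordinate j)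
    reduced : Killed Fs (rB ∸ n)
    reduced = reduce hB Fs
    ds : Vec B.Carrier (rB ∸ n)
    ds = proj₁ reduced
    in-image : All (λ d → Σ A.Carrier λ a → f a B.≈ d) ds
    in-image = All.map (λ ker → ker⊆im _ (coordinates-vanish ker)) (proj₂ (proj₂ reduced))
    lifted : Σ (Vec A.Carrier (rB ∸ n)) λ as → Pointwise B._≈_ (map f as) ds
    lifted = preimages f in-image
    as : Vec A.Carrier (rB ∸ n)
    as = proj₁ lifted
    as-free : A.Free as
    as-free xs rel = proj₁ (proj₂ reduced) xs (B.trans (B.sym (B.lin-cong xs (proj₂ lifted)))
                       (B.trans (B.sym (f.hom-lin xs as)) (B.trans (f.⟦⟧-cong rel) f.ε-homo)))

  -- If A ≅ (ℤ/m)^n and equality in B is decidable, extend the coordinates of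
  -- A along f to functionals on B and kill them: the image under g of the
  -- remaining free family is free in C.
  upper-bound-A : IsFinite A → IsFinite B → (∀ x y → Dec (x B.≈ y)) →
                  ∀ {n} (φ : Vec (Fin m) n → A.Carrier) →
                  IsGroupIsomorphism (ZmPow m n) A.rawGroup φ →
                  ∀ {rA rB rC} → IsRank A m rA → IsRank B m rB → IsRank C m rC → rB ≤ rA + rC
  upper-bound-A finA finB _≟_ {n} φ iso {rA} {rB} (_ , maxA) hB (_ , maxC) =
    ∸-bound (maxA n (φ , isGroupMonomorphism)) (maxC (rB ∸ n) (FC.free⇒embedding (map g ds) gds-free))
    where
    open IsGroupIsomorphism iso using (isGroupMonomorphism)
    open Coordinates k A torA φ iso
    open ImageFunctional k A B torA torB f f-hom f-injective finA _≟_
    open FunctionalExtension k B torB using (extend)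
    Fs : Fin n → B.Functional
    Fs j = proj₁ (extend finB (image-functional (coordinate j)))
    Fs-on-image : ∀ j a → B.Functional.ap (Fs j) (f a) ≡ₘ A.Functional.ap (coordinate j) a
    Fs-on-image j a = ≡ₘ-trans (proj₂ (extend finB (image-functional (coordinate j))) (in-image a))
                               (transported-spec (coordinate j) B.refl)
    reduced : Killed Fs (rB ∸ n)
    reduced = reduce hB Fs
    ds : Vec B.Carrier (rB ∸ n)
    ds = proj₁ reduced
    -- A relation xs on g(ds) gives lin xs ds ≈ f a; every coordinate of a is
    -- then the value of some Fs j on lin xs ds, which vanishes.
    gds-free : C.Free (map g ds)
    gds-free xs rel = proj₁ (proj₂ reduced) xs (B.trans (B.sym fa≈) (B.trans (f.⟦⟧-cong a≈ε) f.ε-homo))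
      where
      g-rel : g (B.lin xs ds) C.≈ C.ε
      g-rel = C.trans (g.hom-lin xs ds) rel
      a = proj₁ (ker⊆im _ g-rel)
      fa≈ : f a B.≈ B.lin xs ds
      fa≈ = proj₂ (ker⊆im _ g-rel)
      a≈ε : a A.≈ A.ε
      a≈ε = coordinates-vanish λ j →
        ≡ₘ-trans (≡ₘ-sym (Fs-on-image j a))
          (≡ₘ-trans (B.Functional.ap-cong (Fs j) fa≈)
            (B.∈-lin (B.ker-subgroup (Fs j)) xs (All.map (λ ker → ker j) (proj₂ (proj₂ reduced)))))

  -- The decidability needed above holds up to double negation, and the
  -- conclusion is a decidable inequality.
  upper-bound-A′ : IsFinite A → IsFinite B →
                   ∀ {n} (φ : Vec (Fin m) n → A.Carrier) →
                   IsGroupIsomorphism (ZmPow m n) A.rawGroup φ →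
                   ∀ {rA rB rC} → IsRank A m rA → IsRank B m rB → IsRank C m rC → rB ≤ rA + rC
  upper-bound-A′ finA finB φ iso {rA} {rB} {rC} hA hB hC =
    decidable-stable (rB ≤? rA + rC)
      (λ ≰ → ¬¬-decidable-≈ B finB (λ _≟_ → ≰ (upper-bound-A finA finB _≟_ φ iso hA hB hC)))

lemma2p4 : (m : ℕ) .{{_ : NonZero m}} → 1 < m →
    (A B C : AbelianGroup 0ℓ 0ℓ) →
    IsFinite A → IsFinite B → IsFinite C →
    IsTorsion A m → IsTorsion B m → IsTorsion C m →
    (f : AbelianGroup.Carrier A → AbelianGroup.Carrier B) →
    (g : AbelianGroup.Carrier B → AbelianGroup.Carrier C) →
    ShortExact A B C f g →
    (rA rB rC : ℕ) → IsRank A m rA → IsRank B m rB → IsRank C m rC →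
    (rA + rC ≤ rB)
    × ((Σ ℕ (λ n → IsoZmPow A m n) ⊎ Σ ℕ (λ n → IsoZmPow C m n)) → rB ≡ rA + rC)
lemma2p4 (suc (suc k)) (s≤s (s≤s z≤n)) A B C finA finB _ torA torB torC f g exact rA rB rC hA hB hC =
  lower , λ
    { (inj₁ (_ , φ , iso)) → ≤-antisym (upper-bound-A′ finA finB φ iso hA hB hC) lower
    ; (inj₂ (_ , φ , iso)) → ≤-antisym (upper-bound-C φ iso hA hB hC) lower }
  where
  open ShortExactRanks k A B C torA torB torC f g exact
  lower : rA + rC ≤ rB
  lower = lower-bound hA hB hC
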